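{- There exist constants $c>0$ and $n_0$ such that for every integer $n\ge n_0$ there is a set $B$ of $n$ natural numbers such that the product set $B.B=\{bb' : b,b'\in B\}$ contains an arithmetic progression of length at least $c\, n\log n$.
   Context: The length of an arithmetic progression is its number of terms. -}

module Defs where

open import Data.Nat using (ℕ; _+_; _*_; _<_)
open import Data.Product using (Σ; _×_; ∃-syntax)
open import Data.List using (List)
open import Data.List.Membership.Propositional using (_∈_)
open import Relation.Binary.PropositionalEquality using (_≡_)

_∈ProdSet_ : ℕ → List ℕ → Set
x ∈ProdSet B = ∃[ b ] ∃[ b' ] (b ∈ B × b' ∈ B × b * b' ≡ x)

-- The arithmetic progression a, a+d, ..., a+(L-1)d (L terms) is contained in S
-- (S given as a predicate).  Nondegeneracy (d ≥ 1) is imposed in the statement.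
APIn : (ℕ → Set) → (a d L : ℕ) → Set
APIn S a d L = (i : ℕ) → i < L → S (a + i * d)

module Submission where

-- Put N = 16ʲ, M = 8ʲ, E = 4ʲ. Every x ≤ N is u·r with u the largest divisor
-- of x not exceeding M, and the cofactor r is then either at most M or prime.
-- So if B contains 1, …, M and the primes in (M, N], then B·B contains the
-- progression 1, …, N. Chebyshev's bound ∏_{p ≤ n} p ≤ 8ⁿ (the primes in
-- (m+1, 2m+1] divide (2m+1 choose m) ≤ 2^(2m+1)) leaves at most N/j primes in
-- (M, N], so B has at most M + N/j ≤ n elements once 2N ≤ nj; pad it above N
-- to exactly n elements. For the largest such j, n·log₂ n ≤ 160·N.

open import Algebra.Properties.CommutativeSemigroup using (x∙yz≈y∙xz)
open import Data.List using (List; []; _∷_; length; filter; applyDownFrom)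
open import Data.List.Membership.Propositional using (_∈_)
open import Data.List.Membership.Propositional.Properties
  using (∈-applyDownFrom⁺; ∈-applyDownFrom⁻; ∈-filter⁺; ∈-filter⁻)
open import Data.List.Properties
  using (length-applyDownFrom; length-filter; filter-accept; filter-reject; filter-none)
open import Data.List.Relation.Unary.All as All using (All; []; _∷_)
open import Data.List.Relation.Unary.All.Properties using (all-filter)
open import Data.List.Relation.Unary.Any using (here; there)
open import Data.List.Relation.Unary.Unique.Propositional using (Unique)
open import Data.List.Relation.Unary.Unique.Propositional.Properties using (applyDownFrom⁺₁; filter⁺)
open import Data.Nat hiding (parity)
open import Data.Nat.Combinatorics using (_C_; nCk+nC[k+1]≡[n+1]C[k+1]; k![n∸k]!∣n!; nCk≡n!/k![n-k]!)
open import Data.Nat.Divisibility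
open import Data.Nat.Induction using (<-rec)
open import Data.Nat.ListAction using (product)
open import Data.Nat.ListAction.Properties using (∈⇒∣product)
open import Data.Nat.Logarithm using (⌊log₂_⌋; ⌊log₂⌋-mono-≤; ⌊log₂[2^n]⌋≡n)
open import Data.Nat.Primality
open import Data.Nat.Properties
open import Data.Nat.Tactic.RingSolver using (solve-∀)
open import Data.Product using (_×_; _,_; proj₁; proj₂; ∃-syntax)
open import Data.Sum using (_⊎_; inj₁; inj₂)
open import Function using (_∘_)
open import Relation.Binary.PropositionalEquality
  using (_≡_; refl; sym; trans; cong; subst; module ≡-Reasoning)
open import Relation.Nullary using (Dec; yes; no; ¬_)
open import Relation.Nullary.Decidable using (_×-dec_; _⊎-dec_)
open import Relation.Nullary.Negation using (contradiction)
open import Relation.Unary using (Pred; Decidable)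

open import Defs

-- n ∷ n ∸ 1 ∷ … ∷ 1 ∷ []: descending, so recursion on n peels off the largest element.
oneTo : ℕ → List ℕ
oneTo n = applyDownFrom suc n

∈-oneTo⁺ : ∀ {n x} → 1 ≤ x → x ≤ n → x ∈ oneTo n
∈-oneTo⁺ {x = suc x} _ x<n = ∈-applyDownFrom⁺ suc x<n

∈-oneTo⁻ : ∀ {n x} → x ∈ oneTo n → 1 ≤ x × x ≤ n
∈-oneTo⁻ x∈ with _ , i<n , refl ← ∈-applyDownFrom⁻ suc x∈ = s≤s z≤n , i<n

oneTo-unique : ∀ n → Unique (oneTo n)
oneTo-unique n = applyDownFrom⁺₁ suc n (λ j<i _ → (<⇒≢ j<i) ∘ sym ∘ suc-injective)

length-oneTo : ∀ n → length (oneTo n) ≡ n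
length-oneTo = length-applyDownFrom suc

n!≡product-oneTo : ∀ n → n ! ≡ product (oneTo n)
n!≡product-oneTo zero = refl
n!≡product-oneTo (suc n) = cong (suc n *_) (n!≡product-oneTo n)

module _ {p} {P : Pred ℕ p} (P? : Decidable P) where

  length-filter-∷ : ∀ x xs → length (filter P? xs) ≤ length (filter P? (x ∷ xs))
  length-filter-∷ x xs with P? x
  ... | yes _ = n≤1+n _
  ... | no  _ = ≤-refl

  length-filter-oneTo-+ : ∀ N p → (∀ x → N < x → P x) →
                          length (filter P? (oneTo (N + p))) ≡ length (filter P? (oneTo N)) + p
  length-filter-oneTo-+ N zero _ rewrite +-identityʳ N = sym (+-identityʳ _)
  length-filter-oneTo-+ N (suc p) P>N rewrite +-suc N p with P? (suc (N + p))
  ... | yes _ = trans (cong suc (length-filter-oneTo-+ N p P>N)) (sym (+-suc _ p))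
  ... | no ¬P = contradiction (P>N _ (s≤s (m≤m+n N p))) ¬P

length-filter-≤?-oneTo : ∀ M n → length (filter (_≤? M) (oneTo n)) ≤ M
length-filter-≤?-oneTo M zero = z≤n
length-filter-≤?-oneTo M (suc n) with suc n ≤? M
... | yes n<M = begin
  length (filter (_≤? M) (oneTo (suc n)))   ≡⟨ cong length (filter-accept (_≤? M) n<M) ⟩
  suc (length (filter (_≤? M) (oneTo n)))   ≤⟨ s≤s (length-filter (_≤? M) (oneTo n)) ⟩
  suc (length (oneTo n))                    ≡⟨ cong suc (length-oneTo n) ⟩
  suc n                                     ≤⟨ n<M ⟩
  M                                         ∎
  where open ≤-Reasoning
... | no  n≮M = ≤-trans (≤-reflexive (cong length (filter-reject (_≤? M) n≮M)))
                        (length-filter-≤?-oneTo M n)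

module _ {p q r} {P : Pred ℕ p} {Q : Pred ℕ q} {R : Pred ℕ r}
         (P? : Decidable P) (Q? : Decidable Q) (R? : Decidable R) where

  length-filter-⊎ : ∀ xs → All (λ x → P x → Q x ⊎ R x) xs →
                    length (filter P? xs) ≤ length (filter Q? xs) + length (filter R? xs)
  length-filter-⊎ [] [] = z≤n
  length-filter-⊎ (x ∷ xs) (split ∷ splits) with P? x
  ... | no _ = ≤-trans (length-filter-⊎ xs splits)
                   (+-mono-≤ (length-filter-∷ Q? x xs) (length-filter-∷ R? x xs))
  ... | yes p with split p
  ...   | inj₁ q = begin
    suc (length (filter P? xs))
      ≤⟨ s≤s (length-filter-⊎ xs splits) ⟩
    suc (length (filter Q? xs) + length (filter R? xs))
      ≤⟨ s≤s (+-monoʳ-≤ _ (length-filter-∷ R? x xs)) ⟩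
    suc (length (filter Q? xs)) + length (filter R? (x ∷ xs))
      ≡⟨ cong (λ ys → length ys + _) (filter-accept Q? q) ⟨
    length (filter Q? (x ∷ xs)) + length (filter R? (x ∷ xs))
      ∎
    where open ≤-Reasoning
  ...   | inj₂ r = begin
    suc (length (filter P? xs))
      ≤⟨ s≤s (length-filter-⊎ xs splits) ⟩
    suc (length (filter Q? xs) + length (filter R? xs))
      ≤⟨ s≤s (+-monoˡ-≤ _ (length-filter-∷ Q? x xs)) ⟩
    suc (length (filter Q? (x ∷ xs)) + length (filter R? xs))
      ≡⟨ +-suc _ _ ⟨
    length (filter Q? (x ∷ xs)) + suc (length (filter R? xs))
      ≡⟨ cong (λ ys → _ + length ys) (filter-accept R? r) ⟨
    length (filter Q? (x ∷ xs)) + length (filter R? (x ∷ xs))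
      ∎
    where open ≤-Reasoning

∈-oneTo⇒between : ∀ {k p y} → k < p → y ∈ oneTo k → 0 < y × y < p
∈-oneTo⇒between k<p y∈ with 0<y , y≤k ← ∈-oneTo⁻ y∈ = 0<y , ≤-<-trans y≤k k<p

prime∤product : ∀ {p} → Prime p → ∀ ys → All (λ y → 0 < y × y < p) ys → ¬ p ∣ product ys
prime∤product pr [] [] p∣1 = ¬prime[1] (subst Prime (∣1⇒≡1 p∣1) pr)
prime∤product pr (y ∷ ys) ((0<y , y<p) ∷ bounds) p∣ with euclidsLemma y (product ys) pr p∣
... | inj₁ p∣y  = <⇒≱ y<p (∣⇒≤ ⦃ >-nonZero 0<y ⦄ p∣y)
... | inj₂ p∣ys = prime∤product pr ys bounds p∣ys

prime∤k! : ∀ {p k} → Prime p → k < p → ¬ p ∣ k !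
prime∤k! {k = k} pr k<p p∣k! =
  prime∤product pr (oneTo k) (All.tabulate (∈-oneTo⇒between k<p))
                (subst (_ ∣_) (n!≡product-oneTo k) p∣k!)

m≤n⇒m∣n! : ∀ {p n} → 0 < p → p ≤ n → p ∣ n !
m≤n⇒m∣n! {n = n} 0<p p≤n = subst (_ ∣_) (sym (n!≡product-oneTo n)) (∈⇒∣product (∈-oneTo⁺ 0<p p≤n))

module _ {r} {R : Pred ℕ r} (R? : Decidable R) where

  product-filter-oneTo-∣ : ∀ n {x} → (∀ {p} → p ∈ filter R? (oneTo n) → Prime p × p ∣ x) →
                           product (filter R? (oneTo n)) ∣ x
  product-filter-oneTo-∣ zero _ = 1∣ _
  product-filter-oneTo-∣ (suc n) primeDivisors with R? (suc n)
  ... | no  _ = product-filter-oneTo-∣ n primeDivisors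
  ... | yes _ with primeDivisors (here refl) | product-filter-oneTo-∣ n (primeDivisors ∘ there)
  ...   | pr , p∣x | divides q x≡q*P with euclidsLemma q _ pr (subst (suc n ∣_) x≡q*P p∣x)
  ...     | inj₁ p∣q = subst (_ ∣_) (sym x≡q*P) (*-monoˡ-∣ _ p∣q)
  ...     | inj₂ p∣P = contradiction p∣P (prime∤product pr _ (All.tabulate λ y∈ →
                         ∈-oneTo⇒between ≤-refl (proj₁ (∈-filter⁻ R? y∈))))

nCk≤2^n : ∀ n k → n C k ≤ 2 ^ n
nCk≤2^n zero    zero    = ≤-refl
nCk≤2^n zero    (suc k) = z≤n
nCk≤2^n (suc n) zero    = ≤-trans (nCk≤2^n n zero) (m≤m+n _ _)
nCk≤2^n (suc n) (suc k) = begin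
  suc n C suc k       ≡⟨ nCk+nC[k+1]≡[n+1]C[k+1] n k ⟨
  n C k + n C suc k   ≤⟨ +-mono-≤ (nCk≤2^n n k) (nCk≤2^n n (suc k)) ⟩
  2 ^ n + 2 ^ n       ≡⟨ cong (2 ^ n +_) (+-identityʳ (2 ^ n)) ⟨
  2 ^ suc n           ∎
  where open ≤-Reasoning

n!≡nCk*k![n∸k]! : ∀ {n k} → k ≤ n → n ! ≡ (n C k) * (k ! * (n ∸ k) !)
n!≡nCk*k![n∸k]! {n} {k} k≤n = begin
  n !                                ≡⟨ m∣n⇒n≡quotient*m d∣n! ⟩
  quotient d∣n! * d                  ≡⟨ cong (_* d) (n/m≡quotient d∣n!) ⟨
  (n ! / d) * d                      ≡⟨ cong (_* d) (nCk≡n!/k![n-k]! k≤n) ⟨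
  (n C k) * d                        ∎
  where
  open ≡-Reasoning
  d = k ! * (n ∸ k) !
  d∣n! : d ∣ n !
  d∣n! = k![n∸k]!∣n! k≤n
  instance
    d≢0 : NonZero d
    d≢0 = m*n≢0 (k !) ((n ∸ k) !) ⦃ k !≢0 ⦄ ⦃ (n ∸ k) !≢0 ⦄

nCk≢0 : ∀ {n k} → k ≤ n → NonZero (n C k)
nCk≢0 {n} {k} k≤n = m*n≢0⇒m≢0 (n C k) ⦃ subst NonZero (n!≡nCk*k![n∸k]! k≤n) (n !≢0) ⦄

prime∣nCk : ∀ {p n k} → Prime p → k < p → n ∸ k < p → p ≤ n → p ∣ n C k
prime∣nCk {p} {n} {k} pr k<p n∸k<p p≤n
  with euclidsLemma (n C k) _ pr (subst (p ∣_) (n!≡nCk*k![n∸k]! k≤n) (m≤n⇒m∣n! 0<p p≤n))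
  where
  0<p = ≤-<-trans z≤n k<p
  k≤n = ≤-trans (<⇒≤ k<p) p≤n
... | inj₁ p∣nCk = p∣nCk
... | inj₂ p∣k![n∸k]! with euclidsLemma (k !) _ pr p∣k![n∸k]!
...   | inj₁ p∣k!     = contradiction p∣k! (prime∤k! pr k<p)
...   | inj₂ p∣[n∸k]! = contradiction p∣[n∸k]! (prime∤k! pr n∸k<p)

primorial : ℕ → ℕ
primorial n = product (filter prime? (oneTo n))

primorial>0 : ∀ n → primorial n > 0
primorial>0 n = productOfPrimes≥1 (all-filter prime? (oneTo n))

PrimeAbove : ℕ → Pred ℕ _
PrimeAbove b x = b < x × Prime x

primeAbove? : ∀ b → Decidable (PrimeAbove b)
primeAbove? b x = (b <? x) ×-dec prime? x

primesAbove : ℕ → ℕ → List ℕ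
primesAbove b n = filter (primeAbove? b) (oneTo n)

primorial-split : ∀ {b n} → b ≤ n → primorial n ≡ product (primesAbove b n) * primorial b
primorial-split {b} {n} b≤n with m≤n⇒m<n∨m≡n b≤n
... | inj₂ refl = begin
  primorial b
    ≡⟨ *-identityˡ (primorial b) ⟨
  product [] * primorial b
    ≡⟨ cong (λ ps → product ps * primorial b) (filter-none (primeAbove? b) noneAbove) ⟨
  product (primesAbove b b) * primorial b
    ∎
  where
  open ≡-Reasoning
  noneAbove : All (λ x → ¬ PrimeAbove b x) (oneTo b)
  noneAbove = All.tabulate λ x∈ (b<x , _) → <⇒≱ b<x (proj₂ (∈-oneTo⁻ x∈))
primorial-split {b} {suc n} _ | inj₁ (s≤s b≤n) = step (prime? (suc n))
  where
  open ≡-Reasoning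
  step : Dec (Prime (suc n)) → primorial (suc n) ≡ product (primesAbove b (suc n)) * primorial b
  step (yes pr) = begin
    primorial (suc n)
      ≡⟨ cong product (filter-accept prime? pr) ⟩
    suc n * primorial n
      ≡⟨ cong (suc n *_) (primorial-split b≤n) ⟩
    suc n * (product (primesAbove b n) * primorial b)
      ≡⟨ *-assoc (suc n) (product (primesAbove b n)) (primorial b) ⟨
    product (suc n ∷ primesAbove b n) * primorial b
      ≡⟨ cong (λ ps → product ps * primorial b) (filter-accept (primeAbove? b) (s≤s b≤n , pr)) ⟨
    product (primesAbove b (suc n)) * primorial b
      ∎
  step (no ¬pr) = begin
    primorial (suc n)
      ≡⟨ cong product (filter-reject prime? ¬pr) ⟩
    primorial n
      ≡⟨ primorial-split b≤n ⟩
    product (primesAbove b n) * primorial b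
      ≡⟨ cong (λ ps → product ps * primorial b) (filter-reject (primeAbove? b) (¬pr ∘ proj₂)) ⟨
    product (primesAbove b (suc n)) * primorial b
      ∎

primorial[2m+1]≤2^[2m+1]*primorial[m+1] : ∀ m →
  primorial (m + suc m) ≤ 2 ^ (m + suc m) * primorial (suc m)
primorial[2m+1]≤2^[2m+1]*primorial[m+1] m = begin
  primorial n                                 ≡⟨ primorial-split (m≤n+m (suc m) m) ⟩
  product (primesAbove (suc m) n) * primorial (suc m)
    ≤⟨ *-monoˡ-≤ (primorial (suc m)) (∣⇒≤ ⦃ nCk≢0 (m≤m+n m (suc m)) ⦄ middlePrimes∣nCm) ⟩
  (n C m) * primorial (suc m)                 ≤⟨ *-monoˡ-≤ (primorial (suc m)) (nCk≤2^n n m) ⟩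
  2 ^ n * primorial (suc m)                   ∎
  where
  open ≤-Reasoning
  n = m + suc m
  middlePrimes∣nCm : product (primesAbove (suc m) n) ∣ n C m
  middlePrimes∣nCm = product-filter-oneTo-∣ (primeAbove? (suc m)) n λ {p} p∈ →
    let p∈n , m+1<p , pr = ∈-filter⁻ (primeAbove? (suc m)) p∈
    in pr , prime∣nCk pr (<-trans (n<1+n m) m+1<p)
                         (subst (_< p) (sym (m+n∸m≡n m (suc m))) m+1<p)
                         (proj₂ (∈-oneTo⁻ p∈n))

data Parity : ℕ → Set where
  even : ∀ m → Parity (m + m)
  odd  : ∀ m → Parity (m + suc m)

parity : ∀ n → Parity n
parity zero = even zero
parity (suc n) with parity n
... | even m = subst Parity (+-suc m m) (odd m)
... | odd  m = even (suc m)

¬prime[m+m] : ∀ m → 1 < m → ¬ Prime (m + m)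
¬prime[m+m] m 1<m = composite⇒¬prime (composite {d = 2} 2<m+m (divides m (m+m≡m*2 m)))
  where
  2<m+m : 2 < m + m
  2<m+m = +-mono-≤ 1<m (<⇒≤ 1<m)
  m+m≡m*2 : ∀ m → m + m ≡ m * 2
  m+m≡m*2 = solve-∀

primorial≤8^n : ∀ n → primorial n ≤ 2 ^ (3 * n)
primorial≤8^n = <-rec _ bound
  where
  open ≤-Reasoning
  bound : ∀ n → (∀ {k} → k < n → primorial k ≤ 2 ^ (3 * k)) → primorial n ≤ 2 ^ (3 * n)
  bound n rec with parity n
  ... | even zero          = ≤-refl
  ... | odd  zero          = s≤s z≤n
  ... | even (suc zero)    = s≤s (s≤s z≤n)
  ... | even (suc (suc m)) = begin
    primorial (suc n′)
      ≡⟨ cong product (filter-reject prime? (¬prime[m+m] (suc (suc m)) (s≤s (s≤s z≤n)))) ⟩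
    primorial n′                ≤⟨ rec ≤-refl ⟩
    2 ^ (3 * n′)                ≤⟨ ^-monoʳ-≤ 2 (*-monoʳ-≤ 3 (n≤1+n n′)) ⟩
    2 ^ (3 * suc n′)            ∎
    where n′ = suc m + suc (suc m)
  ... | odd (suc m) = begin
    primorial n                       ≤⟨ primorial[2m+1]≤2^[2m+1]*primorial[m+1] (suc m) ⟩
    2 ^ n * primorial (suc (suc m))   ≤⟨ *-monoʳ-≤ (2 ^ n) (rec (s≤s (m≤n+m (suc (suc m)) m))) ⟩
    2 ^ n * 2 ^ (3 * suc (suc m))     ≡⟨ ^-distribˡ-+-* 2 n _ ⟨
    2 ^ (n + 3 * suc (suc m))         ≤⟨ ^-monoʳ-≤ 2 (≤-trans (m≤m+n _ m) (≤-reflexive (exponent m))) ⟩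
    2 ^ (3 * n)                       ∎
    where
    exponent : ∀ m → (suc m + suc (suc m)) + 3 * suc (suc m) + m ≡ 3 * (suc m + suc (suc m))
    exponent = solve-∀

^-length≤product : ∀ {b} xs → All (b ≤_) xs → b ^ length xs ≤ product xs
^-length≤product []       []           = ≤-refl
^-length≤product (x ∷ xs) (b≤x ∷ b≤xs) = *-mono-≤ b≤x (^-length≤product xs b≤xs)

^-length-primesAbove≤8^n : ∀ {b n} → b ≤ n → b ^ length (primesAbove b n) ≤ 2 ^ (3 * n)
^-length-primesAbove≤8^n {b} {n} b≤n = begin
  b ^ length (primesAbove b n)                  ≤⟨ ^-length≤product (primesAbove b n) (All.tabulate b≤p) ⟩
  product (primesAbove b n)                     ≤⟨ m≤m*n _ (primorial b) ⦃ >-nonZero (primorial>0 b) ⦄ ⟩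
  product (primesAbove b n) * primorial b       ≡⟨ primorial-split b≤n ⟨
  primorial n                                   ≤⟨ primorial≤8^n n ⟩
  2 ^ (3 * n)                                   ∎
  where
  open ≤-Reasoning
  b≤p : ∀ {p} → p ∈ primesAbove b n → b ≤ p
  b≤p p∈ = <⇒≤ (proj₁ (proj₂ (∈-filter⁻ (primeAbove? b) {xs = oneTo n} p∈)))

^-cancelʳ-≤ : ∀ m {a b} → 1 < m → m ^ a ≤ m ^ b → a ≤ b
^-cancelʳ-≤ m 1<m mᵃ≤mᵇ = ≮⇒≥ λ b<a → <⇒≱ (^-monoʳ-< m 1<m b<a) mᵃ≤mᵇ

n<2^n : ∀ n → n < 2 ^ n
n<2^n zero    = s≤s z≤n
n<2^n (suc n) = begin-strict
  suc n           ≤⟨ n<2^n n ⟩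
  2 ^ n           <⟨ m<m+n (2 ^ n) (m^n>0 2 n) ⟩
  2 ^ n + 2 ^ n   ≡⟨ cong (2 ^ n +_) (+-identityʳ (2 ^ n)) ⟨
  2 ^ suc n       ∎
  where open ≤-Reasoning

module _ {p} {P : Pred ℕ p} (P? : Decidable P) where

  greatest-≤ : ∀ {b} k → b ≤ k → P b →
               ∃[ u ] (b ≤ u × u ≤ k × P u × (∀ {v} → u < v → v ≤ k → ¬ P v))
  greatest-≤ k b≤k Pb with m≤n⇒m<n∨m≡n b≤k
  ... | inj₂ refl = _ , ≤-refl , ≤-refl , Pb , λ u<v v≤u → contradiction v≤u (<⇒≱ u<v)
  greatest-≤ (suc k) _ Pb | inj₁ (s≤s b≤k) with P? (suc k)
  ... | yes Pk = suc k , m≤n⇒m≤1+n b≤k , ≤-refl , Pk , λ k<v v≤k → contradiction v≤k (<⇒≱ k<v)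
  ... | no ¬Pk with u , b≤u , u≤k , Pu , maximal ← greatest-≤ k b≤k Pb =
    u , b≤u , m≤n⇒m≤1+n u≤k , Pu , maximal′
    where
    maximal′ : ∀ {v} → u < v → v ≤ suc k → ¬ P v
    maximal′ u<v v≤k with m≤n⇒m<n∨m≡n v≤k
    ... | inj₁ (s≤s v≤k′) = maximal u<v v≤k′
    ... | inj₂ refl       = ¬Pk

  threshold : ∀ {a} d → P a → ¬ P (a + d) → ∃[ j ] (a ≤ j × P j × ¬ P (suc j))
  threshold {a} zero    Pa ¬Pa+0 = contradiction (subst P (sym (+-identityʳ a)) Pa) ¬Pa+0
  threshold {a} (suc d) Pa ¬Pa+d with P? (suc a)
  ... | no ¬Pa+1 = a , ≤-refl , Pa , ¬Pa+1
  ... | yes Pa+1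
    with j , a<j , Pj , ¬Pj+1 ← threshold d Pa+1 (subst (¬_ ∘ P) (+-suc a d) ¬Pa+d) =
    j , <⇒≤ a<j , Pj , ¬Pj+1

SmallOrPrime : ℕ → Pred ℕ _
SmallOrPrime M r = r ≤ M ⊎ Prime r

-- Take u the largest divisor of x below M. A cofactor r = x/u above M has no
-- divisor e ∈ (1, E], since e·u would be a larger divisor, forcing M·r < e·x ≤ M²;
-- as r ≤ E², r is prime.
factorise-small×smallOrPrime : ∀ {E M N} → 1 ≤ M → E * N ≤ M * M → N ≤ E * E →
  ∀ {x} → 1 ≤ x → x ≤ N →
  ∃[ u ] ∃[ r ] (u * r ≡ x × 1 ≤ u × u ≤ M × 1 ≤ r × r ≤ x × SmallOrPrime M r)
factorise-small×smallOrPrime {E} {M} {N} 1≤M EN≤MM N≤EE {x} 1≤x x≤N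
  with greatest-≤ (_∣? x) M 1≤M (1∣ x)
... | u , 1≤u , u≤M , divides r x≡r*u , maximal =
  u , r , u*r≡x , 1≤u , u≤M , 1≤r , r≤x , smallOrPrime
  where
  u*r≡x : u * r ≡ x
  u*r≡x = trans (*-comm u r) (sym x≡r*u)
  1≤r : 1 ≤ r
  1≤r = n≢0⇒n>0 λ r≡0 → <⇒≢ 1≤x (sym (trans x≡r*u (cong (_* u) r≡0)))
  r≤x : r ≤ x
  r≤x = subst (r ≤_) (sym x≡r*u) (m≤m*n r u ⦃ >-nonZero 1≤u ⦄)
  smallOrPrime : SmallOrPrime M r
  smallOrPrime with r ≤? M
  ... | yes r≤M = inj₁ r≤M
  ... | no  r≰M =
    inj₂ (rough∧square>⇒prime ⦃ n>1⇒nonTrivial (<-≤-trans (s≤s 1≤M) M<r) ⦄ rough r<[E+1]²)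
    where
    M<r : M < r
    M<r = ≰⇒> r≰M
    r<[E+1]² : suc E * suc E > r
    r<[E+1]² = begin-strict
      r               ≤⟨ ≤-trans r≤x (≤-trans x≤N N≤EE) ⟩
      E * E           <⟨ *-mono-< (n<1+n E) (n<1+n E) ⟩
      suc E * suc E   ∎
      where open ≤-Reasoning
    rough : suc E Rough r
    rough (hasNonTrivialDivisor {e} e<E+1 e∣r) = <⇒≱ M<r (<⇒≤ (*-cancelˡ-< M r M Mr<MM))
      where
      e*u∣x : e * u ∣ x
      e*u∣x = subst (e * u ∣_) (sym x≡r*u) (*-monoˡ-∣ u e∣r)
      u<e*u : u < e * u
      u<e*u = subst (u <_) (*-comm u e) (m<m*n u e ⦃ >-nonZero 1≤u ⦄ (nonTrivial⇒n>1 e))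
      M<e*u : M < e * u
      M<e*u = ≰⇒> λ e*u≤M → maximal u<e*u e*u≤M e*u∣x
      Mr<MM : M * r < M * M
      Mr<MM = begin-strict
        M * r         <⟨ *-monoˡ-< r ⦃ >-nonZero 1≤r ⦄ M<e*u ⟩
        e * u * r     ≡⟨ *-assoc e u r ⟩
        e * (u * r)   ≡⟨ cong (e *_) u*r≡x ⟩
        e * x         ≤⟨ *-mono-≤ (≤-pred e<E+1) x≤N ⟩
        E * N         ≤⟨ EN≤MM ⟩
        M * M         ∎
        where open ≤-Reasoning

module LongProgressionInProductSet {n j : ℕ} (1≤j : 1 ≤ j) (2N≤nj : 2 * 2 ^ (4 * j) ≤ n * j) where

  E M N : ℕ
  E = 2 ^ (2 * j)
  M = 2 ^ (3 * j)
  N = 2 ^ (4 * j)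

  Member : Pred ℕ _
  Member x = SmallOrPrime M x ⊎ N < x

  member? : Decidable Member
  member? x = ((x ≤? M) ⊎-dec prime? x) ⊎-dec (N <? x)

  core : List ℕ
  core = filter member? (oneTo N)

  padding : ℕ
  padding = n ∸ length core

  B : List ℕ
  B = filter member? (oneTo (N + padding))

  EN≡MM : E * N ≡ M * M
  EN≡MM = begin
    2 ^ (2 * j) * 2 ^ (4 * j)   ≡⟨ ^-distribˡ-+-* 2 (2 * j) (4 * j) ⟨
    2 ^ (2 * j + 4 * j)         ≡⟨ cong (2 ^_) (exponents j) ⟩
    2 ^ (3 * j + 3 * j)         ≡⟨ ^-distribˡ-+-* 2 (3 * j) (3 * j) ⟩
    2 ^ (3 * j) * 2 ^ (3 * j)   ∎
    where
    open ≡-Reasoning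
    exponents : ∀ j → 2 * j + 4 * j ≡ 3 * j + 3 * j
    exponents = solve-∀

  N≡EE : N ≡ E * E
  N≡EE = trans (cong (2 ^_) (exponents j)) (^-distribˡ-+-* 2 (2 * j) (2 * j))
    where
    exponents : ∀ j → 4 * j ≡ 2 * j + 2 * j
    exponents = solve-∀

  M≤N : M ≤ N
  M≤N = ^-monoʳ-≤ 2 (*-monoˡ-≤ j (n≤1+n 3))

  2M≤n : 2 * M ≤ n
  2M≤n = *-cancelʳ-≤ (2 * M) n (2 ^ j) ⦃ m^n≢0 2 j ⦄ (begin
    2 * M * 2 ^ j                 ≡⟨ *-assoc 2 M (2 ^ j) ⟩
    2 * (2 ^ (3 * j) * 2 ^ j)     ≡⟨ cong (2 *_) (^-distribˡ-+-* 2 (3 * j) j) ⟨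
    2 * 2 ^ (3 * j + j)           ≡⟨ cong (λ e → 2 * 2 ^ e) (exponents j) ⟩
    2 * N                         ≤⟨ 2N≤nj ⟩
    n * j                         ≤⟨ *-monoʳ-≤ n (<⇒≤ (n<2^n j)) ⟩
    n * 2 ^ j                     ∎)
    where
    open ≤-Reasoning
    exponents : ∀ j → 3 * j + j ≡ 4 * j
    exponents = solve-∀

  K : ℕ
  K = length (primesAbove M N)

  2K≤n : 2 * K ≤ n
  2K≤n = *-cancelˡ-≤ j ⦃ >-nonZero 1≤j ⦄ (begin
    j * (2 * K)     ≡⟨ x∙yz≈y∙xz *-commutativeSemigroup j 2 K ⟩
    2 * (j * K)     ≤⟨ *-monoʳ-≤ 2 jK≤N ⟩
    2 * N           ≤⟨ 2N≤nj ⟩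
    n * j           ≡⟨ *-comm n j ⟩
    j * n           ∎)
    where
    open ≤-Reasoning
    jK≤N : j * K ≤ N
    jK≤N = *-cancelˡ-≤ 3 (^-cancelʳ-≤ 2 (s≤s (s≤s z≤n)) (begin
      2 ^ (3 * (j * K))   ≡⟨ cong (2 ^_) (*-assoc 3 j K) ⟨
      2 ^ (3 * j * K)     ≡⟨ ^-*-assoc 2 (3 * j) K ⟨
      M ^ K               ≤⟨ ^-length-primesAbove≤8^n M≤N ⟩
      2 ^ (3 * N)         ∎))

  length-core≤n : length core ≤ n
  length-core≤n = *-cancelˡ-≤ 2 (begin
    2 * length core
      ≤⟨ *-monoʳ-≤ 2 core≤small+large ⟩
    2 * (length (filter (_≤? M) (oneTo N)) + K)
      ≤⟨ *-monoʳ-≤ 2 (+-monoˡ-≤ K (length-filter-≤?-oneTo M N)) ⟩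
    2 * (M + K)
      ≡⟨ *-distribˡ-+ 2 M K ⟩
    2 * M + 2 * K
      ≤⟨ +-mono-≤ 2M≤n 2K≤n ⟩
    n + n
      ≡⟨ cong (n +_) (+-identityʳ n) ⟨
    2 * n
      ∎)
    where
    open ≤-Reasoning
    split : ∀ {x} → x ∈ oneTo N → Member x → x ≤ M ⊎ PrimeAbove M x
    split _  (inj₁ (inj₁ x≤M)) = inj₁ x≤M
    split {x} _ (inj₁ (inj₂ pr)) with x ≤? M
    ... | yes x≤M = inj₁ x≤M
    ... | no  x≰M = inj₂ (≰⇒> x≰M , pr)
    split x∈ (inj₂ N<x) = contradiction (proj₂ (∈-oneTo⁻ x∈)) (<⇒≱ N<x)
    core≤small+large : length core ≤ length (filter (_≤? M) (oneTo N)) + K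
    core≤small+large = length-filter-⊎ member? (_≤? M) (primeAbove? M) (oneTo N) (All.tabulate split)

  length-B : length B ≡ n
  length-B = trans (length-filter-oneTo-+ member? N padding (λ _ → inj₂))
                   (m+[n∸m]≡n length-core≤n)

  B-unique : Unique B
  B-unique = filter⁺ member? (oneTo-unique (N + padding))

  smallOrPrime∈B : ∀ {x} → 1 ≤ x → x ≤ N → SmallOrPrime M x → x ∈ B
  smallOrPrime∈B 1≤x x≤N x∈ =
    ∈-filter⁺ member? (∈-oneTo⁺ 1≤x (≤-trans x≤N (m≤m+n N padding))) (inj₁ x∈)

  [1,N]⊆B·B : ∀ {x} → 1 ≤ x → x ≤ N → x ∈ProdSet B
  [1,N]⊆B·B 1≤x x≤N
    with u , r , u*r≡x , 1≤u , u≤M , 1≤r , r≤x , r∈ ←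
         factorise-small×smallOrPrime {E} {M} {N} (m^n>0 2 (3 * j))
           (≤-reflexive EN≡MM) (≤-reflexive N≡EE) 1≤x x≤N =
    u , r , smallOrPrime∈B 1≤u (≤-trans u≤M M≤N) (inj₁ u≤M) ,
            smallOrPrime∈B 1≤r (≤-trans r≤x x≤N) r∈ , u*r≡x

  progression : APIn (_∈ProdSet B) 1 1 N
  progression i i<N = [1,N]⊆B·B (s≤s z≤n) (subst (λ i′ → suc i′ ≤ N) (sym (*-identityʳ i)) i<N)

productSet-contains-[1,16ʲ] : ∀ {n j} → 1 ≤ j → 2 * 2 ^ (4 * j) ≤ n * j →
  ∃[ B ] (Unique B × length B ≡ n × APIn (_∈ProdSet B) 1 1 (2 ^ (4 * j)))
productSet-contains-[1,16ʲ] {n} 1≤j 2N≤nj = B , B-unique , length-B , progression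
  where open LongProgressionInProductSet {n} 1≤j 2N≤nj

n*⌊log₂n⌋≤160*16ʲ : ∀ {n j} → n * suc j < 2 * 2 ^ (4 * suc j) →
                    n * ⌊log₂ n ⌋ ≤ 160 * 2 ^ (4 * j)
n*⌊log₂n⌋≤160*16ʲ {n} {j} n[j+1]<2*16ʲ⁺¹ = begin
  n * ⌊log₂ n ⌋                   ≤⟨ *-monoʳ-≤ n log₂n≤5[j+1] ⟩
  n * (5 * suc j)                 ≡⟨ x∙yz≈y∙xz *-commutativeSemigroup n 5 (suc j) ⟩
  5 * (n * suc j)                 ≤⟨ *-monoʳ-≤ 5 (<⇒≤ n[j+1]<2*16ʲ⁺¹) ⟩
  5 * (2 * 2 ^ (4 * suc j))       ≡⟨ cong (λ e → 5 * (2 * 2 ^ e)) (*-distribˡ-+ 4 1 j) ⟩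
  5 * (2 * 2 ^ (4 + 4 * j))       ≡⟨ cong (λ t → 5 * (2 * t)) (^-distribˡ-+-* 2 4 (4 * j)) ⟩
  5 * (2 * (16 * 2 ^ (4 * j)))    ≡⟨ constants (2 ^ (4 * j)) ⟩
  160 * 2 ^ (4 * j)               ∎
  where
  open ≤-Reasoning
  constants : ∀ x → 5 * (2 * (16 * x)) ≡ 160 * x
  constants = solve-∀
  exponent : ∀ j → suc (4 * suc j) + j ≡ 5 * suc j
  exponent = solve-∀
  log₂n≤5[j+1] : ⌊log₂ n ⌋ ≤ 5 * suc j
  log₂n≤5[j+1] = begin
    ⌊log₂ n ⌋                       ≤⟨ ⌊log₂⌋-mono-≤ (≤-trans (m≤m*n n (suc j)) (<⇒≤ n[j+1]<2*16ʲ⁺¹)) ⟩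
    ⌊log₂ (2 ^ suc (4 * suc j)) ⌋   ≡⟨ ⌊log₂[2^n]⌋≡n _ ⟩
    suc (4 * suc j)                 ≤⟨ m≤m+n _ j ⟩
    suc (4 * suc j) + j             ≡⟨ exponent j ⟩
    5 * suc j                       ∎

Admissible : ℕ → Pred ℕ _
Admissible n j = 2 * 2 ^ (4 * j) ≤ n * j

admissible? : ∀ n → Decidable (Admissible n)
admissible? n j = 2 * 2 ^ (4 * j) ≤? n * j

¬admissible[n+1] : ∀ n → ¬ Admissible n (suc n)
¬admissible[n+1] n = <⇒≱ (begin-strict
  n * suc n                   ≤⟨ *-mono-≤ (<⇒≤ (n<2^n n)) (n<2^n n) ⟩
  2 ^ n * 2 ^ n               ≡⟨ ^-distribˡ-+-* 2 n n ⟨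
  2 ^ (n + n)                 ≤⟨ ^-monoʳ-≤ 2 (+-mono-≤ (n≤1+n n) n≤3[n+1]) ⟩
  2 ^ (4 * suc n)             <⟨ ^-monoʳ-< 2 (s≤s (s≤s z≤n)) (n<1+n (4 * suc n)) ⟩
  2 * 2 ^ (4 * suc n)         ∎)
  where
  open ≤-Reasoning
  n≤3[n+1] : n ≤ 3 * suc n
  n≤3[n+1] = ≤-trans (n≤1+n n) (m≤m+n (suc n) (2 * suc n))

theorem2 : ∃[ q ] ∃[ n₀ ] ((n : ℕ) → n₀ ≤ n →
             ∃[ B ] (Unique B × length B ≡ n ×
               ∃[ a ] ∃[ d ] ∃[ L ] (1 ≤ d × n * ⌊log₂ n ⌋ ≤ suc q * L
                 × APIn (λ x → x ∈ProdSet B) a d L)))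
theorem2 = 159 , 32 , λ n 32≤n →
  let admissible[1] = subst (32 ≤_) (sym (*-identityʳ n)) 32≤n
      j , 1≤j , admissible[j] , ¬admissible[j+1] =
        threshold (admissible? n) n admissible[1] (¬admissible[n+1] n)
      B , B-unique , length-B , progression = productSet-contains-[1,16ʲ] 1≤j admissible[j]
  in B , B-unique , length-B , 1 , 1 , 2 ^ (4 * j) , ≤-refl ,
     n*⌊log₂n⌋≤160*16ʲ {n} {j} (≰⇒> ¬admissible[j+1]) , progression
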